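{- Every $\omega$-sequence in $\mathbf{iE}$ has a colimit in $\mathbf{iE}$. More precisely, if $(\mathsf{C}_i,\varphi_i)_{i\ge1}$ is an $\omega$-sequence in $\mathbf{iE}$ with $\mathsf{C}_i=(A_i,r_i,X_i)$ and each $\varphi_i^+:A_i\to A_{i+1}$ the inclusion map, then the following cocone $(\psi_i:\mathsf{C}_i\to\mathsf{C})_{i\ge1}$ is a colimit in $\mathbf{iE}$: $\mathsf{C}=(A,r,X)$ with $A=\bigcup_{i\ge1}A_i$, $X=\{(x_j)_{j\ge1}: x_j\in X_j,\ \varphi_j^-(x_{j+1})=x_j \text{ for all } j\ge1\}$, $r(a,(x_j)_{j\ge1})=r_i(a,x_i)$ whenever $a\in A_i$; $\psi_i^+$ the inclusion $A_i\to A$ and $\psi_i^-((x_j)_{j\ge1})=x_i$.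
   Context: $\Sigma$ is a set containing at least two distinct elements, denoted $0$ and $1$. A Chu space over $\Sigma$ is a triple $(A,r,X)$ with sets $A,X$ and a function $r:A\times X\to\Sigma$. A morphism $\varphi=(\varphi^+,\varphi^-):(A,r,X)\to(B,s,Y)$ consists of functions $\varphi^+:A\to B$, $\varphi^-:Y\to X$ with $s(\varphi^+(a),y)=r(a,\varphi^-(y))$ for all $a,y$; composition is $\varphi_2\circ\varphi_1=(\varphi_2^+\circ\varphi_1^+,\varphi_1^-\circ\varphi_2^-)$. $(A,r,X)$ is extensional if for $x,y\in X$, $r(-,x)=r(-,y)$ implies $x=y$. $\mathbf{E}$ is the category of extensional Chu spaces over $\Sigma$ with these morphisms, and $\mathbf{iE}$ its subcategory with the same objects whose morphisms are the monomorphisms of $\mathbf{E}$. An $\omega$-sequence in $\mathbf{iE}$ is a family of objects $\mathsf{C}_i$ and $\mathbf{iE}$-morphisms $\varphi_i:\mathsf{C}_i\to\mathsf{C}_{i+1}$ ($i\ge1$); a cocone to $\mathsf{C}$ is a family of $\mathbf{iE}$-morphisms $\psi_i:\mathsf{C}_i\to\mathsf{C}$ with $\psi_{i+1}\circ\varphi_i=\psi_i$; it is a colimit in $\mathbf{iE}$ if for every cocone $(\psi'_i:\mathsf{C}_i\to\mathsf{C}')$ in $\mathbf{iE}$ there is a unique $\mathbf{iE}$-morphism $\psi:\mathsf{C}\to\mathsf{C}'$ with $\psi\circ\psi_i=\psi'_i$ for all $i$. -}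

module Defs where

open import Level using (0ℓ)
open import Data.Nat using (ℕ; suc; _≤′_; ≤′-refl; ≤′-step)
open import Data.Nat.Properties using (≤-total; ≤⇒≤′)
open import Data.Sum using (inj₁; inj₂)
open import Data.Product using (Σ; _,_; proj₁; proj₂; _×_)
open import Relation.Binary.PropositionalEquality using (_≡_; refl; sym; trans; cong; cong₂)
open import Relation.Nullary using (¬_)

record Alphabet : Set₁ where
  field
    Sym  : Set
    s0   : Sym
    s1   : Sym
    s0≢s1 : ¬ (s0 ≡ s1)

module Chu (Σ′ : Alphabet) where
  open Alphabet Σ′

  record ChuSpace : Set₁ where
    constructor chu
    field
      A : Set
      X : Set
      r : A → X → Sym
  open ChuSpace public

  Extensional : ChuSpace → Set
  Extensional C = ∀ (x y : X C) → (∀ a → r C a x ≡ r C a y) → x ≡ y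

  record Hom (C D : ChuSpace) : Set where
    constructor hom
    field
      fun⁺ : A C → A D
      fun⁻ : X D → X C
      adj  : ∀ a y → r D (fun⁺ a) y ≡ r C a (fun⁻ y)
  open Hom public

  _∘ₕ_ : ∀ {B C D} → Hom C D → Hom B C → Hom B D
  _∘ₕ_ {B} {C} {D} g f = hom (λ a → fun⁺ g (fun⁺ f a)) (λ y → fun⁻ f (fun⁻ g y))
    (λ a y → trans′ (adj g (fun⁺ f a) y) (adj f a (fun⁻ g y)))
    where
    trans′ : ∀ {u v w : Sym} → u ≡ v → v ≡ w → u ≡ w
    trans′ _≡_.refl q = q

  _≈ₕ_ : ∀ {C D} → Hom C D → Hom C D → Set
  f ≈ₕ g = (∀ a → fun⁺ f a ≡ fun⁺ g a) × (∀ y → fun⁻ f y ≡ fun⁻ g y)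

  IsMono : ∀ {C D} → Hom C D → Set₁
  IsMono {C} {D} φ =
    ∀ (B : ChuSpace) → Extensional B → (f g : Hom B C) →
    (φ ∘ₕ f) ≈ₕ (φ ∘ₕ g) → f ≈ₕ g

  -- The union A = ⋃ Aᵢ is given as a carrier type `U`, each Aᵢ as the
  -- subset { a ∈ U ∣ P i a } (P i a proof-irrelevant), with
  -- Aᵢ ⊆ Aᵢ₊₁ and U = ⋃ Aᵢ.  Indices start at 0 instead of 1.

  record InclSeq : Set₁ where
    field
      U      : Set
      P      : ℕ → U → Set
      P-prop : ∀ i a (p q : P i a) → p ≡ q
      P-incl : ∀ i a → P i a → P (suc i) a
      P-cover : ∀ a → Σ ℕ (λ i → P i a)
      Xs     : ℕ → Set
      rs     : ∀ i → Σ U (P i) → Xs i → Sym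
      φ⁻     : ∀ i → Xs (suc i) → Xs i
      φ-adj  : ∀ i (a : Σ U (P i)) (y : Xs (suc i)) →
               rs (suc i) (proj₁ a , P-incl i (proj₁ a) (proj₂ a)) y ≡ rs i a (φ⁻ i y)

    Cs : ℕ → ChuSpace
    Cs i = chu (Σ U (P i)) (Xs i) (rs i)

    φ : ∀ i → Hom (Cs i) (Cs (suc i))
    φ i = hom (λ a → proj₁ a , P-incl i (proj₁ a) (proj₂ a)) (φ⁻ i) (φ-adj i)

  IsωSeqiE : InclSeq → Set₁
  IsωSeqiE S = (∀ i → Extensional (Cs i)) × (∀ i → IsMono (φ i))
    where open InclSeq S

  module Colim (S : InclSeq) where
    open InclSeq S

    Xc : Set
    Xc = Σ ((j : ℕ) → Xs j) (λ x → ∀ j → φ⁻ j (x (suc j)) ≡ x j)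

    rc : U → Xc → Sym
    rc a x = rs (proj₁ (P-cover a)) (a , proj₂ (P-cover a)) (proj₁ x (proj₁ (P-cover a)))

    C : ChuSpace
    C = chu U Xc rc

    -- Helper facts: membership propagates upwards, and rᵢ(a,xᵢ) does not
    -- depend on the index i with a ∈ Aᵢ (so r is well defined).
    lift : ∀ {i j} a → i ≤′ j → P i a → P j a
    lift a ≤′-refl p = p
    lift a (≤′-step {n} le) p = P-incl n a (lift a le p)

    up : ∀ {i j} a (le : i ≤′ j) (p : P i a) (q : P j a) (x : Xc) →
         rs j (a , q) (proj₁ x j) ≡ rs i (a , p) (proj₁ x i)
    up a ≤′-refl p q x = cong (λ z → rs _ (a , z) (proj₁ x _)) (P-prop _ a q p)
    up {i} a (≤′-step {n} le) p q x =
      trans (cong (λ z → rs (suc n) (a , z) (proj₁ x (suc n)))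
                  (P-prop (suc n) a q (P-incl n a (lift a le p))))
      (trans (φ-adj n (a , lift a le p) (proj₁ x (suc n)))
      (trans (cong (rs n (a , lift a le p)) (proj₂ x n))
             (up a le p (lift a le p) x)))

    indep : ∀ {i j} a (p : P i a) (q : P j a) (x : Xc) →
            rs j (a , q) (proj₁ x j) ≡ rs i (a , p) (proj₁ x i)
    indep {i} {j} a p q x with ≤-total i j
    ... | inj₁ le = up a (≤⇒≤′ le) p q x
    ... | inj₂ le = sym (up a (≤⇒≤′ le) q p x)

    ψ : ∀ i → Hom (Cs i) C
    ψ i = hom proj₁ (λ x → proj₁ x i)
      (λ a x → indep (proj₁ a) (proj₂ a) (proj₂ (P-cover (proj₁ a))) x)

  module _ (S : InclSeq) where
    open InclSeq S

    IsCoconeiE : (C : ChuSpace) → (∀ i → Hom (Cs i) C) → Set₁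
    IsCoconeiE C ψ =
      (∀ i → IsMono (ψ i)) × (∀ i → (ψ (suc i) ∘ₕ φ i) ≈ₕ ψ i)

    IsColimitiE : (C : ChuSpace) → (∀ i → Hom (Cs i) C) → Set₁
    IsColimitiE C ψ =
      Extensional C × IsCoconeiE C ψ ×
      (∀ (C′ : ChuSpace) → Extensional C′ → (ψ′ : ∀ i → Hom (Cs i) C′) →
        IsCoconeiE C′ ψ′ →
        Σ (Hom C C′) (λ θ → IsMono θ × (∀ i → (θ ∘ₕ ψ i) ≈ₕ ψ′ i) ×
          (∀ (θ′ : Hom C C′) → IsMono θ′ → (∀ i → (θ′ ∘ₕ ψ i) ≈ₕ ψ′ i) →
            θ′ ≈ₕ θ)))

{-# OPTIONS --safe #-}
module Submission where

-- A morphism out of an extensional space is determined by its positive part, and in E a morphism is mono exactly when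
-- its positive part is injective. Hence a cocone ψ′ into C′ forces the mediating map: a ∈ Aᵢ goes
-- to ψ′ᵢ⁺ a and y to the thread (ψ′ⱼ⁻ y)ⱼ; it is mono because any two points of the union already
-- lie in a common Aₖ, on which ψ′ₖ⁺ is injective.

open import Defs
open import Level using (0ℓ)
open import Axiom.Extensionality.Propositional using (Extensionality)
open import Axiom.UniquenessOfIdentityProofs.WithK using (uip)
open import Data.Nat using (ℕ; suc; _≤′_; ≤′-refl; ≤′-step; _⊔_)
open import Data.Nat.Properties using (≤-total; ≤⇒≤′; m≤m⊔n; m≤n⊔m)
open import Data.Product using (Σ; _,_; proj₁; proj₂; _×_)
open import Data.Sum using (inj₁; inj₂)
open import Data.Unit using (⊤; tt)
open import Function.Definitions using (Injective)
open import Relation.Binary.PropositionalEquality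
  using (_≡_; refl; sym; trans; cong; module ≡-Reasoning)

module Morphisms (Σ′ : Alphabet) where
  open Alphabet Σ′
  open Chu Σ′

  ≈ₕ-from-fun⁺ : ∀ {B D} → Extensional B → (f g : Hom B D) →
                 (∀ b → fun⁺ f b ≡ fun⁺ g b) → f ≈ₕ g
  ≈ₕ-from-fun⁺ {B} {D} extB f g f⁺≗g⁺ = f⁺≗g⁺ , λ y →
    extB (fun⁻ f y) (fun⁻ g y) λ b → begin
      r B b (fun⁻ f y)  ≡⟨ sym (adj f b y) ⟩
      r D (fun⁺ f b) y  ≡⟨ cong (λ d → r D d y) (f⁺≗g⁺ b) ⟩
      r D (fun⁺ g b) y  ≡⟨ adj g b y ⟩
      r B b (fun⁻ g y)  ∎
    where open ≡-Reasoning

  injective⁺⇒mono : ∀ {C D} (m : Hom C D) → Injective _≡_ _≡_ (fun⁺ m) → IsMono m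
  injective⁺⇒mono m inj B extB f g m∘f≈m∘g =
    ≈ₕ-from-fun⁺ extB f g (λ b → inj (proj₁ m∘f≈m∘g b))

  -- Probe the mono with the one-point space whose states are the symbols themselves; it is
  -- extensional, and a point a of C gives the morphism whose negative part is r(a,-).
  mono⇒injective⁺ : ∀ {C D} (m : Hom C D) → IsMono m → Injective _≡_ _≡_ (fun⁺ m)
  mono⇒injective⁺ {C} {D} m mono {a} {a′} ma≡ma′ =
    proj₁ (mono point (λ _ _ eq → eq tt) (at a) (at a′) ((λ _ → ma≡ma′) , r⁻≗)) tt
    where
    point : ChuSpace
    point = chu ⊤ Sym (λ _ s → s)

    at : A C → Hom point C
    at c = hom (λ _ → c) (r C c) (λ _ _ → refl)

    r⁻≗ : ∀ y → r C a (fun⁻ m y) ≡ r C a′ (fun⁻ m y)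
    r⁻≗ y = trans (sym (adj m a y)) (trans (cong (λ d → r D d y) ma≡ma′) (adj m a′ y))

module Sequence (Σ′ : Alphabet) (S : Chu.InclSeq Σ′) where
  open Chu Σ′
  open InclSeq S
  open Colim S using (lift)

  ∈-≡ : ∀ {i} (u v : Σ U (P i)) → proj₁ u ≡ proj₁ v → u ≡ v
  ∈-≡ {i} (a , p) (.a , q) refl = cong (a ,_) (P-prop i a p q)

  common-index : ∀ a b → Σ ℕ (λ k → P k a × P k b)
  common-index a b with P-cover a | P-cover b
  ... | i , p | j , q =
    i ⊔ j , lift a (≤⇒≤′ (m≤m⊔n i j)) p , lift b (≤⇒≤′ (m≤n⊔m i j)) q

  module Compatible {B : Set} (f : ∀ i → Σ U (P i) → B)
    (f-incl : ∀ i a (p : P i a) → f (suc i) (a , P-incl i a p) ≡ f i (a , p)) where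

    f-up : ∀ {i j} a (i≤j : i ≤′ j) (p : P i a) (q : P j a) → f j (a , q) ≡ f i (a , p)
    f-up a ≤′-refl p q = cong (f _) (∈-≡ _ _ refl)
    f-up a (≤′-step {n} i≤n) p q = begin
      f (suc n) (a , q)                           ≡⟨ cong (f (suc n)) (∈-≡ _ _ refl) ⟩
      f (suc n) (a , P-incl n a (lift a i≤n p))   ≡⟨ f-incl n a (lift a i≤n p) ⟩
      f n (a , lift a i≤n p)                      ≡⟨ f-up a i≤n p _ ⟩
      f _ (a , p)                                 ∎
      where open ≡-Reasoning

    f-index-irrelevant : ∀ {i j} a (p : P i a) (q : P j a) → f j (a , q) ≡ f i (a , p)
    f-index-irrelevant {i} {j} a p q with ≤-total i j
    ... | inj₁ i≤j = f-up a (≤⇒≤′ i≤j) p q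
    ... | inj₂ j≤i = sym (f-up a (≤⇒≤′ j≤i) q p)

module Colimit (Σ′ : Alphabet) (ext : Extensionality 0ℓ 0ℓ)
  (S : Chu.InclSeq Σ′) (extCs : ∀ i → Chu.Extensional Σ′ (Chu.InclSeq.Cs S i)) where
  open Chu Σ′
  open InclSeq S
  open Colim S
  open Morphisms Σ′
  open Sequence Σ′ S

  index : U → ℕ
  index a = proj₁ (P-cover a)

  ∈index : ∀ a → P (index a) a
  ∈index a = proj₂ (P-cover a)

  -- Two threads agree at each level by extensionality of Cᵢ; the coherence proofs then agree by UIP.
  extensional-C : Extensional C
  extensional-C (x , x-coh) (y , y-coh) rx≗ry =
    thread-≡ (ext λ i → extCs i (x i) (y i) λ { (a , p) → level-≡ a p }) y-coh
    where
    level-≡ : ∀ {i} a (p : P i a) → rs i (a , p) (x i) ≡ rs i (a , p) (y i)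
    level-≡ a p = trans (indep a (∈index a) p (x , x-coh))
                        (trans (rx≗ry a) (sym (indep a (∈index a) p (y , y-coh))))

    thread-≡ : ∀ {y′} (x≡y′ : x ≡ y′) y′-coh → (x , x-coh) ≡ (y′ , y′-coh)
    thread-≡ refl y′-coh = cong (x ,_) (ext λ j → uip _ _)

  cocone-C : IsCoconeiE S C ψ
  cocone-C = (λ i → injective⁺⇒mono (ψ i) (∈-≡ _ _))
           , (λ i → (λ _ → refl) , (λ x → proj₂ x i))

  module Mediating (C′ : ChuSpace) (ψ′ : ∀ i → Hom (Cs i) C′) (cocone : IsCoconeiE S C′ ψ′) where
    open Compatible (λ i → fun⁺ (ψ′ i)) (λ i a p → proj₁ (proj₂ cocone i) (a , p))

    θ : Hom C C′
    θ = hom (λ a → fun⁺ (ψ′ (index a)) (a , ∈index a))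
            (λ y → (λ j → fun⁻ (ψ′ j) y) , (λ j → proj₂ (proj₂ cocone j) y))
            (λ a → adj (ψ′ (index a)) (a , ∈index a))

    θ-injective⁺ : Injective _≡_ _≡_ (fun⁺ θ)
    θ-injective⁺ {a} {b} θa≡θb with common-index a b
    ... | k , p , q = cong proj₁ (mono⇒injective⁺ (ψ′ k) (proj₁ cocone k) (begin
      fun⁺ (ψ′ k) (a , p)                ≡⟨ f-index-irrelevant a (∈index a) p ⟩
      fun⁺ (ψ′ (index a)) (a , ∈index a)  ≡⟨ θa≡θb ⟩
      fun⁺ (ψ′ (index b)) (b , ∈index b)  ≡⟨ sym (f-index-irrelevant b (∈index b) q) ⟩
      fun⁺ (ψ′ k) (b , q)                ∎))
      where open ≡-Reasoning

    θ-factors : ∀ i → (θ ∘ₕ ψ i) ≈ₕ ψ′ i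
    θ-factors i = (λ { (a , p) → f-index-irrelevant a p (∈index a) }) , (λ _ → refl)

    θ-unique : ∀ (θ′ : Hom C C′) → (∀ i → (θ′ ∘ₕ ψ i) ≈ₕ ψ′ i) → θ′ ≈ₕ θ
    θ-unique θ′ θ′-factors =
      ≈ₕ-from-fun⁺ extensional-C θ′ θ λ a → proj₁ (θ′-factors (index a)) (a , ∈index a)

theorem3p4 : (Σ′ : Alphabet) → Extensionality 0ℓ 0ℓ →
    let open Chu Σ′ in
    (S : InclSeq) → IsωSeqiE S → IsColimitiE S (Colim.C S) (Colim.ψ S)
theorem3p4 Σ′ ext S (extCs , _) = extensional-C , cocone-C , λ C′ _ ψ′ cocone →
  let open Mediating C′ ψ′ cocone in
  θ , injective⁺⇒mono θ θ-injective⁺ , θ-factors , λ θ′ _ → θ-unique θ′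
  where
  open Morphisms Σ′ using (injective⁺⇒mono)
  open Colimit Σ′ ext S extCs
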